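{- Let $k\ge 1$ and $\sigma\in S_n(132)$. (1) $\mathrm{mmp}^{(k,0,0,0)}(\sigma)$ equals the number of nodes $\eta$ of the binary tree $\theta_n(\sigma)$ such that the path from $\eta$ to the root of $\theta_n(\sigma)$ contains at least $k$ left edges. (2) $\mathrm{mmp}^{(0,0,k,0)}(\sigma)$ equals the number of nodes $\eta$ of $\theta_n(\sigma)$ whose left subtree has at least $k$ nodes.
   Context: For $\sigma=\sigma_1\cdots\sigma_n\in S_n$ and a position $i$: $\sigma_i$ matches $MMP(a,b,c,d)$ ($a,b,c,d\in\mathbb{N}$) if there are at least $a$ indices $j>i$ with $\sigma_j>\sigma_i$, at least $b$ indices $j<i$ with $\sigma_j>\sigma_i$, at least $c$ indices $j<i$ with $\sigma_j<\sigma_i$, and at least $d$ indices $j>i$ with $\sigma_j<\sigma_i$; $\mathrm{mmp}^{(a,b,c,d)}(\sigma)$ is the number of such $i$. $S_n(132)$ is the set of 132-avoiding permutations of $[n]$. For a sequence $w$ of distinct integers, $\mathrm{red}[w]$ replaces the $i$-th smallest entry by $i$. $\mathcal{B}_n$ is the set of rooted binary trees with $n$ nodes (each node has an optional left child and an optional right child). Define $\theta_n:S_n(132)\to\mathcal{B}_n$ recursively: let $\sigma_i=n$; the tree has a root; if $i>1$ the root has a left child whose subtree is $\theta_{i-1}(\mathrm{red}[\sigma_1\cdots\sigma_{i-1}])$; if $i<n$ the root has a right child whose subtree is $\theta_{n-i}(\sigma_{i+1}\cdots\sigma_n)$. A left edge joins a node to its left child. The left subtree of a node is the subtree rooted at its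 left child (empty, of size 0, if there is none). -}

module Defs where

open import Data.Nat using (ℕ; zero; suc; _+_; _≤_; _<_; _≤?_; _<?_; _≟_)
open import Data.Fin using (Fin; toℕ)
open import Data.List using (List; []; _∷_; length; filter; map; upTo; allFin; lookup; takeWhile; drop)
open import Data.Product using (_×_)
open import Relation.Nullary using (¬_)
open import Relation.Nullary.Decidable using (_×-dec_; ¬?)
open import Relation.Binary.PropositionalEquality using (_≡_)
open import Data.List.Relation.Binary.Permutation.Propositional using (_↭_)

IsPerm : ℕ → List ℕ → Set
IsPerm n σ = σ ↭ map suc (upTo n)

Avoids132 : List ℕ → Set
Avoids132 σ = (i j l : Fin (length σ)) → toℕ i < toℕ j → toℕ j < toℕ l →
  ¬ (lookup σ i < lookup σ l × lookup σ l < lookup σ j)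

aboveRight : (σ : List ℕ) → Fin (length σ) → ℕ
aboveRight σ i = length (filter (λ j → (toℕ i <? toℕ j) ×-dec (lookup σ i <? lookup σ j)) (allFin (length σ)))

aboveLeft : (σ : List ℕ) → Fin (length σ) → ℕ
aboveLeft σ i = length (filter (λ j → (toℕ j <? toℕ i) ×-dec (lookup σ i <? lookup σ j)) (allFin (length σ)))

belowLeft : (σ : List ℕ) → Fin (length σ) → ℕ
belowLeft σ i = length (filter (λ j → (toℕ j <? toℕ i) ×-dec (lookup σ j <? lookup σ i)) (allFin (length σ)))

belowRight : (σ : List ℕ) → Fin (length σ) → ℕ
belowRight σ i = length (filter (λ j → (toℕ i <? toℕ j) ×-dec (lookup σ j <? lookup σ i)) (allFin (length σ)))

mmp : ℕ → ℕ → ℕ → ℕ → List ℕ → ℕ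
mmp a b c d σ = length (filter
  (λ i → (a ≤? aboveRight σ i) ×-dec ((b ≤? aboveLeft σ i) ×-dec
         ((c ≤? belowLeft σ i) ×-dec (d ≤? belowRight σ i))))
  (allFin (length σ)))

red : List ℕ → List ℕ
red w = map (λ x → suc (length (filter (λ y → y <? x) w))) w

-- Rooted binary trees; `leaf` is the empty tree, `node l r` a node with
-- (optional) left subtree l and right subtree r.
data BTree : Set where
  leaf : BTree
  node : BTree → BTree → BTree

size : BTree → ℕ
size leaf = 0
size (node l r) = suc (size l + size r)

-- θ with a fuel argument (fuel = length suffices): for σ with σ_i = n,
-- root with left subtree θ(red[σ_1..σ_{i-1}]) and right subtree θ(σ_{i+1}..σ_n).
θ-fuel : ℕ → List ℕ → BTree
θ-fuel _ [] = leaf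
θ-fuel zero (_ ∷ _) = leaf
θ-fuel (suc f) w@(_ ∷ _) =
  let pre = takeWhile (λ x → ¬? (x ≟ length w)) w
      post = drop (suc (length pre)) w
  in node (θ-fuel f (red pre)) (θ-fuel f post)

θ : List ℕ → BTree
θ w = θ-fuel (length w) w

-- Number of nodes whose path to the root contains at least k left edges
-- (e = number of left edges from the current subtree's root to the global root).
leftDepthCount' : ℕ → ℕ → BTree → ℕ
leftDepthCount' k e leaf = 0
leftDepthCount' k e (node l r) with k ≤? e
... | Relation.Nullary.yes _ = suc (leftDepthCount' k (suc e) l + leftDepthCount' k e r)
... | Relation.Nullary.no _ = leftDepthCount' k (suc e) l + leftDepthCount' k e r

leftDepthCount : ℕ → BTree → ℕ
leftDepthCount k t = leftDepthCount' k 0 t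

bigLeftCount : ℕ → BTree → ℕ
bigLeftCount k leaf = 0
bigLeftCount k (node l r) with k ≤? size l
... | Relation.Nullary.yes _ = suc (bigLeftCount k l + bigLeftCount k r)
... | Relation.Nullary.no _ = bigLeftCount k l + bigLeftCount k r

module Submission where

-- Both mmp statistics are sums over the entries of σ; we compute them by scanning the
-- list (largerAfter: at least k larger entries later; smallerBefore: at least k smaller
-- entries earlier). A 132-avoiding permutation w of 1..n splits at its maximum n as
-- pre ++ n ∷ post with every entry of pre above every entry of post, and θ reads w
-- in order: red pre becomes the left subtree, n the root, post the right subtree.
-- Across this split an entry of pre gains exactly one larger later entry (n), matching
-- the one extra left edge above it; n has exactly |pre| = size of its left subtree
-- smaller earlier entries; entries of post gain nothing. Both scans are invariant under
-- the order-preserving relabelling red, so induction along θ shows that list and tree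
-- statistics agree.

open import Defs
open import Level using (Level)
open import Function using (_∘_; id)
open import Data.Empty using (⊥-elim)
open import Data.Product using (_×_; _,_; proj₁; proj₂; Σ-syntax)
open import Data.Nat using (ℕ; zero; suc; _+_; _≤_; _<_; _≤?_; _<?_; _≟_; z≤n; s≤s; s≤s⁻¹)
open import Data.Nat.Properties using (+-assoc; +-comm; +-suc; +-identityʳ; suc-injective; ≤-refl; ≤-trans; ≤-reflexive;
  m≤m+n; m≤n+m; m≤n⇒m≤1+n; <-irrefl; <-asym; <-trans; <-cmp; ≤∧≢⇒<; <⇒≤)
open import Data.Fin using (Fin; toℕ; zero; suc)
open import Data.List using (List; []; _∷_; length; filter; map; upTo; allFin; lookup; takeWhile; drop; tabulate; _++_)
open import Data.List.Properties using (++-identityʳ; length-map; length-++; filter-++; filter-all; filter-none; filter-notAll; map-tabulate; tabulate-lookup; map-upTo)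
open import Data.List.Relation.Unary.All as All using (All; []; _∷_)
open import Data.List.Relation.Unary.All.Properties using (all-takeWhile; ++⁻ˡ) renaming (map⁺ to All-map⁺)
import Data.List.Relation.Unary.Any as Any
open import Data.List.Relation.Unary.Any using (here; there; index)
open import Data.List.Relation.Unary.Any.Properties using (lookup-index)
open import Data.List.Membership.Propositional using (_∈_)
open import Data.List.Membership.Propositional.Properties using (∈-++⁺ˡ; ∈-++⁺ʳ; ∈-map⁻; ∈-upTo⁻)
open import Data.List.Relation.Unary.Unique.Propositional using (Unique)
open import Data.List.Relation.Unary.AllPairs using ([]; _∷_)
open import Data.List.Relation.Unary.Unique.Propositional.Properties using (upTo⁺) renaming (map⁺ to Unique-map⁺)
open import Data.List.Relation.Binary.Sublist.Propositional {A = ℕ} using (_⊆_; []; _∷_; _∷ʳ_; to∈; from∈)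
  renaming (lookup to ⊆-lookup)
open import Data.List.Relation.Binary.Sublist.Propositional.Properties using (++⁺; ++⁺ˡ; ++⁺ʳ)
open import Data.List.Relation.Binary.Permutation.Propositional using (_↭_; ↭-sym; ↭⇒↭ₛ)
open import Data.List.Relation.Binary.Permutation.Setoid.Properties using (Unique-resp-↭)
open import Data.List.Relation.Binary.Permutation.Propositional.Properties using (↭-length; filter-↭; shift; ∈-resp-↭)
open import Data.List.Extrema.Nat using (max; ⊥≤max; xs≤max; argmax-all)
open import Relation.Nullary using (Dec; yes; no; ¬_)
open import Relation.Nullary.Decidable using (_×-dec_; ¬?; decidable-stable)
open import Relation.Unary using (Pred; Decidable)
open import Relation.Binary.Definitions using (tri<; tri≈; tri>)
open import Relation.Binary.PropositionalEquality
open import Relation.Binary.PropositionalEquality.Properties using (setoid)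

private variable
  a p q : Level
  A B : Set a

𝟙 : {P : Set p} → Dec P → ℕ
𝟙 (yes _) = 1
𝟙 (no _) = 0

𝟙-cong : {P : Set p} {Q : Set q} → (P → Q) → (Q → P) → (d : Dec P) (e : Dec Q) → 𝟙 d ≡ 𝟙 e
𝟙-cong f g (yes x) (yes y) = refl
𝟙-cong f g (yes x) (no ¬y) = ⊥-elim (¬y (f x))
𝟙-cong f g (no ¬x) (yes y) = ⊥-elim (¬x (g y))
𝟙-cong f g (no ¬x) (no ¬y) = refl

𝟙-yes : {P : Set p} → P → (d : Dec P) → 𝟙 d ≡ 1
𝟙-yes x (yes _) = refl
𝟙-yes x (no ¬x) = ⊥-elim (¬x x)

𝟙-no : {P : Set p} → ¬ P → (d : Dec P) → 𝟙 d ≡ 0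
𝟙-no ¬x (yes x) = ⊥-elim (¬x x)
𝟙-no ¬x (no _) = refl

count : {P : Pred A p} → Decidable P → List A → ℕ
count P? xs = length (filter P? xs)

module _ {P : Pred A p} (P? : Decidable P) where

  count-∷ : ∀ x xs → count P? (x ∷ xs) ≡ 𝟙 (P? x) + count P? xs
  count-∷ x xs with P? x
  ... | yes _ = refl
  ... | no _ = refl

  count-++ : ∀ xs ys → count P? (xs ++ ys) ≡ count P? xs + count P? ys
  count-++ xs ys = trans (cong length (filter-++ P? xs ys)) (length-++ (filter P? xs))

  count-all : ∀ {xs} → All P xs → count P? xs ≡ length xs
  count-all ps = cong length (filter-all P? ps)

  count-none : ∀ {xs} → All (¬_ ∘ P) xs → count P? xs ≡ 0
  count-none ps = cong length (filter-none P? ps)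

  count-↭ : ∀ {xs ys} → xs ↭ ys → count P? xs ≡ count P? ys
  count-↭ xs↭ys = ↭-length (filter-↭ P? xs↭ys)

count-map : {P : Pred A p} (P? : Decidable P) (f : B → A) (xs : List B) → count P? (map f xs) ≡ count (P? ∘ f) xs
count-map P? f [] = refl
count-map P? f (x ∷ xs) = trans (count-∷ P? (f x) (map f xs))
  (trans (cong (𝟙 (P? (f x)) +_) (count-map P? f xs)) (sym (count-∷ (P? ∘ f) x xs)))

count-cong : {P : Pred A p} {Q : Pred A q} (P? : Decidable P) (Q? : Decidable Q) (xs : List A) →
  (∀ {x} → x ∈ xs → P x → Q x) → (∀ {x} → x ∈ xs → Q x → P x) → count P? xs ≡ count Q? xs
count-cong P? Q? [] f g = refl
count-cong P? Q? (x ∷ xs) f g = begin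
  count P? (x ∷ xs)          ≡⟨ count-∷ P? x xs ⟩
  𝟙 (P? x) + count P? xs     ≡⟨ cong₂ _+_ (𝟙-cong (f (here refl)) (g (here refl)) (P? x) (Q? x))
                                          (count-cong P? Q? xs (f ∘ there) (g ∘ there)) ⟩
  𝟙 (Q? x) + count Q? xs     ≡⟨ count-∷ Q? x xs ⟨
  count Q? (x ∷ xs)          ∎
  where open ≡-Reasoning

module _ {P : Pred A p} {Q : Pred A q} (P? : Decidable P) (Q? : Decidable Q) (P⇒Q : ∀ {x} → P x → Q x) where

  count-mono : ∀ xs → count P? xs ≤ count Q? xs
  count-mono [] = z≤n
  count-mono (x ∷ xs) with P? x | Q? x
  ... | yes _ | yes _ = s≤s (count-mono xs)
  ... | yes p | no ¬q = ⊥-elim (¬q (P⇒Q p))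
  ... | no _  | yes _ = m≤n⇒m≤1+n (count-mono xs)
  ... | no _  | no _  = count-mono xs

  count-strict : ∀ {z xs} → z ∈ xs → Q z → ¬ P z → count P? xs < count Q? xs
  count-strict {xs = x ∷ xs} (here refl) qz ¬pz with P? x | Q? x
  ... | yes pz | _ = ⊥-elim (¬pz pz)
  ... | no _ | yes _ = s≤s (count-mono xs)
  ... | no _ | no ¬qz = ⊥-elim (¬qz qz)
  count-strict {xs = x ∷ xs} (there z∈xs) qz ¬pz with P? x | Q? x
  ... | yes _ | yes _ = s≤s (count-strict z∈xs qz ¬pz)
  ... | yes p | no ¬q = ⊥-elim (¬q (P⇒Q p))
  ... | no _  | yes _ = m≤n⇒m≤1+n (count-strict z∈xs qz ¬pz)
  ... | no _  | no _  = count-strict z∈xs qz ¬pz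

count-threshold-≗ : (k : ℕ) {f g : A → ℕ} → (∀ x → f x ≡ g x) → (xs : List A) →
  count (λ x → k ≤? f x) xs ≡ count (λ x → k ≤? g x) xs
count-threshold-≗ k f≗g xs =
  count-cong _ _ xs (λ {x} _ → subst (k ≤_) (f≗g x)) (λ {x} _ → subst (k ≤_) (sym (f≗g x)))

count-allFin-suc : ∀ {n} {P : Pred (Fin (suc n)) p} (P? : Decidable P) →
  count P? (allFin (suc n)) ≡ 𝟙 (P? zero) + count (P? ∘ suc) (allFin n)
count-allFin-suc {n = n} P? = trans (count-∷ P? zero (tabulate suc))
  (cong (𝟙 (P? zero) +_) (trans (cong (count P?) (sym (map-tabulate id suc))) (count-map P? suc (allFin n))))

count-positions : {P : Pred ℕ p} (P? : Decidable P) (xs : List ℕ) →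
  count (P? ∘ lookup xs) (allFin (length xs)) ≡ count P? xs
count-positions P? xs = trans (sym (count-map P? (lookup xs) (allFin (length xs))))
  (cong (count P?) (trans (map-tabulate id (lookup xs)) (tabulate-lookup xs)))

laterLarger? : (σ : List ℕ) (i : Fin (length σ)) → Decidable (λ j → toℕ i < toℕ j × lookup σ i < lookup σ j)
laterLarger? σ i j = (toℕ i <? toℕ j) ×-dec (lookup σ i <? lookup σ j)

earlierSmaller? : (σ : List ℕ) (i : Fin (length σ)) → Decidable (λ j → toℕ j < toℕ i × lookup σ j < lookup σ i)
earlierSmaller? σ i j = (toℕ j <? toℕ i) ×-dec (lookup σ j <? lookup σ i)

aboveRight-head : ∀ x xs → aboveRight (x ∷ xs) zero ≡ count (x <?_) xs
aboveRight-head x xs = trans (count-allFin-suc (laterLarger? (x ∷ xs) zero))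
  (cong₂ _+_ (𝟙-no (λ { (() , _) }) (laterLarger? (x ∷ xs) zero zero))
    (trans (count-cong (laterLarger? (x ∷ xs) zero ∘ suc) ((x <?_) ∘ lookup xs) (allFin (length xs))
                       (λ _ → proj₂) (λ _ x<y → s≤s z≤n , x<y))
           (count-positions (x <?_) xs)))

aboveRight-tail : ∀ x xs i → aboveRight (x ∷ xs) (suc i) ≡ aboveRight xs i
aboveRight-tail x xs i = trans (count-allFin-suc (laterLarger? (x ∷ xs) (suc i)))
  (cong₂ _+_ (𝟙-no (λ { (() , _) }) (laterLarger? (x ∷ xs) (suc i) zero))
    (count-cong (laterLarger? (x ∷ xs) (suc i) ∘ suc) (laterLarger? xs i) (allFin (length xs))
                (λ _ (i<j , lt) → s≤s⁻¹ i<j , lt) (λ _ (i<j , lt) → s≤s i<j , lt)))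

belowLeft-head : ∀ x xs → belowLeft (x ∷ xs) zero ≡ 0
belowLeft-head x xs =
  count-none (earlierSmaller? (x ∷ xs) zero) {allFin (length (x ∷ xs))} (All.tabulate (λ { _ (() , _) }))

belowLeft-tail : ∀ x xs i → belowLeft (x ∷ xs) (suc i) ≡ 𝟙 (x <? lookup xs i) + belowLeft xs i
belowLeft-tail x xs i = trans (count-allFin-suc (earlierSmaller? (x ∷ xs) (suc i)))
  (cong₂ _+_ (𝟙-cong proj₂ (λ x<y → s≤s z≤n , x<y) (earlierSmaller? (x ∷ xs) (suc i) zero) (x <? lookup xs i))
    (count-cong (earlierSmaller? (x ∷ xs) (suc i) ∘ suc) (earlierSmaller? xs i) (allFin (length xs))
                (λ _ (j<i , lt) → s≤s⁻¹ j<i , lt) (λ _ (j<i , lt) → s≤s j<i , lt)))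

-- largerAfter k e w: entries x of w with at least k entries larger than x after it,
-- where every entry is credited with e additional larger entries.
largerAfter : ℕ → ℕ → List ℕ → ℕ
largerAfter k e [] = 0
largerAfter k e (x ∷ xs) = 𝟙 (k ≤? e + count (x <?_) xs) + largerAfter k e xs

-- smallerBefore k L w: entries x of w with at least k entries smaller than x before it,
-- where L lists the entries preceding w.
smallerBefore : ℕ → List ℕ → List ℕ → ℕ
smallerBefore k L [] = 0
smallerBefore k L (x ∷ xs) = 𝟙 (k ≤? count (_<? x) L) + smallerBefore k (x ∷ L) xs

positions-largerAfter : ∀ k σ → count (λ i → k ≤? aboveRight σ i) (allFin (length σ)) ≡ largerAfter k 0 σ
positions-largerAfter k [] = refl
positions-largerAfter k (x ∷ xs) = trans (count-allFin-suc (λ i → k ≤? aboveRight (x ∷ xs) i)) (cong₂ _+_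
  (cong (λ c → 𝟙 (k ≤? c)) (aboveRight-head x xs))
  (trans (count-threshold-≗ k (aboveRight-tail x xs) (allFin (length xs))) (positions-largerAfter k xs)))

positions-smallerBefore : ∀ k L σ →
  count (λ i → k ≤? count (_<? lookup σ i) L + belowLeft σ i) (allFin (length σ)) ≡ smallerBefore k L σ
positions-smallerBefore k L [] = refl
positions-smallerBefore k L (x ∷ xs) =
  trans (count-allFin-suc (λ i → k ≤? count (_<? lookup (x ∷ xs) i) L + belowLeft (x ∷ xs) i)) (cong₂ _+_
  (cong (λ c → 𝟙 (k ≤? c)) (trans (cong (count (_<? x) L +_) (belowLeft-head x xs)) (+-identityʳ _)))
  (trans (count-threshold-≗ k shift-entry (allFin (length xs))) (positions-smallerBefore k (x ∷ L) xs)))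
  where
  shift-entry : ∀ i → count (_<? lookup xs i) L + belowLeft (x ∷ xs) (suc i)
                    ≡ count (_<? lookup xs i) (x ∷ L) + belowLeft xs i
  shift-entry i = begin
    count (_<? y) L + belowLeft (x ∷ xs) (suc i)      ≡⟨ cong (count (_<? y) L +_) (belowLeft-tail x xs i) ⟩
    count (_<? y) L + (𝟙 (x <? y) + belowLeft xs i)   ≡⟨ +-assoc (count (_<? y) L) _ _ ⟨
    count (_<? y) L + 𝟙 (x <? y) + belowLeft xs i     ≡⟨ cong (_+ belowLeft xs i) (+-comm (count (_<? y) L) _) ⟩
    𝟙 (x <? y) + count (_<? y) L + belowLeft xs i     ≡⟨ cong (_+ belowLeft xs i) (count-∷ (_<? y) x L) ⟨
    count (_<? y) (x ∷ L) + belowLeft xs i            ∎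
    where
    open ≡-Reasoning
    y = lookup xs i

mmp-largerAfter : ∀ k σ → mmp k 0 0 0 σ ≡ largerAfter k 0 σ
mmp-largerAfter k σ = trans (count-cong _ _ (allFin (length σ)) (λ _ → proj₁) (λ _ h → h , z≤n , z≤n , z≤n))
  (positions-largerAfter k σ)

mmp-smallerBefore : ∀ k σ → mmp 0 0 k 0 σ ≡ smallerBefore k [] σ
mmp-smallerBefore k σ = trans (count-cong _ _ (allFin (length σ)) (λ _ → proj₁ ∘ proj₂ ∘ proj₂) (λ _ h → z≤n , z≤n , h , z≤n))
  (positions-smallerBefore k [] σ)

StrictlyMonotoneOn : (ℕ → ℕ) → List ℕ → Set
StrictlyMonotoneOn f S = ∀ {x y} → x ∈ S → y ∈ S → x < y → f x < f y

module _ {f : ℕ → ℕ} {S : List ℕ} (mono : StrictlyMonotoneOn f S) where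

  monotone-reflects : ∀ {x y} → x ∈ S → y ∈ S → f x < f y → x < y
  monotone-reflects {x} {y} x∈S y∈S fx<fy with <-cmp x y
  ... | tri< x<y _ _ = x<y
  ... | tri≈ _ refl _ = ⊥-elim (<-irrefl refl fx<fy)
  ... | tri> _ _ y<x = ⊥-elim (<-asym fx<fy (mono y∈S x∈S y<x))

  monotone-injective : ∀ {x y} → x ∈ S → y ∈ S → x ≢ y → f x ≢ f y
  monotone-injective {x} {y} x∈S y∈S x≢y fx≡fy with <-cmp x y
  ... | tri< x<y _ _ = <-irrefl fx≡fy (mono x∈S y∈S x<y)
  ... | tri≈ _ x≡y _ = x≢y x≡y
  ... | tri> _ _ y<x = <-irrefl (sym fx≡fy) (mono y∈S x∈S y<x)

  count-below-map : ∀ {x} L → x ∈ S → All (_∈ S) L → count (_<? f x) (map f L) ≡ count (_<? x) L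
  count-below-map {x} L x∈S L⊆S = trans (count-map (_<? f x) f L) (count-cong _ (_<? x) L
    (λ y∈L → monotone-reflects (All.lookup L⊆S y∈L) x∈S) (λ y∈L → mono (All.lookup L⊆S y∈L) x∈S))

  count-above-map : ∀ {x} L → x ∈ S → All (_∈ S) L → count (f x <?_) (map f L) ≡ count (x <?_) L
  count-above-map {x} L x∈S L⊆S = trans (count-map (f x <?_) f L) (count-cong _ (x <?_) L
    (λ y∈L → monotone-reflects x∈S (All.lookup L⊆S y∈L)) (λ y∈L → mono x∈S (All.lookup L⊆S y∈L)))

  unique-map : ∀ {w} → All (_∈ S) w → Unique w → Unique (map f w)
  unique-map [] [] = []
  unique-map (x∈S ∷ w⊆S) (x∉w ∷ u) =
    All-map⁺ (All.zipWith (λ (y∈S , x≢y) → monotone-injective x∈S y∈S x≢y) (w⊆S , x∉w)) ∷ unique-map w⊆S u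

  largerAfter-map : ∀ k e {w} → All (_∈ S) w → largerAfter k e (map f w) ≡ largerAfter k e w
  largerAfter-map k e [] = refl
  largerAfter-map k e {x ∷ w} (x∈S ∷ w⊆S) = cong₂ _+_
    (cong (λ c → 𝟙 (k ≤? e + c)) (count-above-map w x∈S w⊆S)) (largerAfter-map k e w⊆S)

  smallerBefore-map : ∀ k {L w} → All (_∈ S) L → All (_∈ S) w → smallerBefore k (map f L) (map f w) ≡ smallerBefore k L w
  smallerBefore-map k L⊆S [] = refl
  smallerBefore-map k {L} {x ∷ w} L⊆S (x∈S ∷ w⊆S) = cong₂ _+_
    (cong (λ c → 𝟙 (k ≤? c)) (count-below-map L x∈S L⊆S)) (smallerBefore-map k (x∈S ∷ L⊆S) w⊆S)

-- rank w x = 1 + #{y ∈ w : y < x}; by definition red w = map (rank w) w.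
rank : List ℕ → ℕ → ℕ
rank w x = suc (count (_<? x) w)

rank-monotone : ∀ w → StrictlyMonotoneOn (rank w) w
rank-monotone w {x} {y} x∈w _ x<y =
  s≤s (count-strict (_<? x) (_<? y) (λ z<x → <-trans z<x x<y) x∈w x<y (<-irrefl refl))

all-∈-self : (w : List ℕ) → All (_∈ w) w
all-∈-self w = All.tabulate id

-- w is reduced when every entry equals its rank, i.e. when red w agrees with w:
-- for duplicate-free w this says w is a permutation of 1, ..., |w|.
Reduced : List ℕ → Set
Reduced w = ∀ {x} → x ∈ w → x ≡ rank w x

red-reduced : ∀ w → Reduced (red w)
red-reduced w y∈red with ∈-map⁻ (rank w) y∈red
... | x , x∈w , refl = cong suc (sym (count-below-map (rank-monotone w) w x∈w (all-∈-self w)))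

reduced-bounded : ∀ {w x} → Reduced w → x ∈ w → x ≤ length w
reduced-bounded {w} {x} red x∈w =
  subst (_≤ length w) (sym (red x∈w)) (filter-notAll (_<? x) w (Any.map (λ { refl → <-irrefl refl }) x∈w))

count-below-maximum : ∀ {y w} → Unique w → y ∈ w → All (_≤ y) w → suc (count (_<? y) w) ≡ length w
count-below-maximum {y} {x ∷ w} (x∉w ∷ _) (here refl) (_ ∷ w≤y) = cong suc (trans (count-∷ (_<? y) x w)
  (cong₂ _+_ (𝟙-no (<-irrefl refl) (x <? y))
    (count-all (_<? y) (All.zipWith (λ (z≤y , y≢z) → ≤∧≢⇒< z≤y (y≢z ∘ sym)) (w≤y , x∉w)))))
count-below-maximum {y} {x ∷ w} (x∉w ∷ u) (there y∈w) (x≤y ∷ w≤y) = cong suc (trans (count-∷ (_<? y) x w)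
  (trans (cong (_+ count (_<? y) w) (𝟙-yes (≤∧≢⇒< x≤y (All.lookup x∉w y∈w)) (x <? y)))
         (count-below-maximum u y∈w w≤y)))

reduced-contains-length : ∀ {x xs} → Unique (x ∷ xs) → Reduced (x ∷ xs) → length (x ∷ xs) ∈ x ∷ xs
reduced-contains-length {x} {xs} u red = subst (_∈ x ∷ xs) (trans (red y∈w) (count-below-maximum u y∈w w≤y)) y∈w
  where
  y = max x xs
  y∈w : y ∈ x ∷ xs
  y∈w = argmax-all id {P = _∈ x ∷ xs} (here refl) (All.tabulate there)
  w≤y : All (_≤ y) (x ∷ xs)
  w≤y = ⊥≤max x xs ∷ xs≤max x xs

Avoids132ˢ : List ℕ → Set
Avoids132ˢ w = ∀ {a b c} → a < c → c < b → ¬ (a ∷ b ∷ c ∷ []) ⊆ w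

positions₂ : ∀ {b c w} → (b ∷ c ∷ []) ⊆ w →
  Σ[ j ∈ Fin (length w) ] Σ[ l ∈ Fin (length w) ] (toℕ j < toℕ l × lookup w j ≡ b × lookup w l ≡ c)
positions₂ (_ ∷ʳ τ) with positions₂ τ
... | j , l , j<l , wj≡b , wl≡c = suc j , suc l , s≤s j<l , wj≡b , wl≡c
positions₂ {c = c} {w = _ ∷ w} (refl ∷ τ) = zero , suc (index c∈w) , s≤s z≤n , refl , sym (lookup-index c∈w)
  where
  c∈w : c ∈ w
  c∈w = to∈ τ

positions₃ : ∀ {a b c w} → (a ∷ b ∷ c ∷ []) ⊆ w →
  Σ[ i ∈ Fin (length w) ] Σ[ j ∈ Fin (length w) ] Σ[ l ∈ Fin (length w) ]
    (toℕ i < toℕ j × toℕ j < toℕ l × lookup w i ≡ a × lookup w j ≡ b × lookup w l ≡ c)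
positions₃ (_ ∷ʳ τ) with positions₃ τ
... | i , j , l , i<j , j<l , wi≡a , wj≡b , wl≡c = suc i , suc j , suc l , s≤s i<j , s≤s j<l , wi≡a , wj≡b , wl≡c
positions₃ (refl ∷ τ) with positions₂ τ
... | j , l , j<l , wj≡b , wl≡c = zero , suc j , suc l , s≤s z≤n , s≤s j<l , refl , wj≡b , wl≡c

avoids132ˢ : ∀ σ → Avoids132 σ → Avoids132ˢ σ
avoids132ˢ σ av a<c c<b τ with positions₃ τ
... | i , j , l , i<j , j<l , refl , refl , refl = av i j l i<j j<l (a<c , c<b)

avoids-prefix : ∀ xs {ys} → Avoids132ˢ (xs ++ ys) → Avoids132ˢ xs
avoids-prefix xs {ys} av a<c c<b τ = av a<c c<b (++⁺ʳ ys τ)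

avoids-suffix : ∀ xs {ys} → Avoids132ˢ (xs ++ ys) → Avoids132ˢ ys
avoids-suffix xs av a<c c<b τ = av a<c c<b (++⁺ˡ xs τ)

⊆-map⁻ : (f : ℕ → ℕ) {ys : List ℕ} (w : List ℕ) → ys ⊆ map f w → Σ[ zs ∈ List ℕ ] (zs ⊆ w × map f zs ≡ ys)
⊆-map⁻ f [] [] = [] , [] , refl
⊆-map⁻ f (x ∷ w) (_ ∷ʳ τ) with ⊆-map⁻ f w τ
... | zs , τ′ , refl = zs , x ∷ʳ τ′ , refl
⊆-map⁻ f (x ∷ w) (refl ∷ τ) with ⊆-map⁻ f w τ
... | zs , τ′ , refl = x ∷ zs , refl ∷ τ′ , refl

avoids-map : ∀ {f w} → StrictlyMonotoneOn f w → Avoids132ˢ w → Avoids132ˢ (map f w)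
avoids-map {f} {w} mono av fa<fc fc<fb τ with ⊆-map⁻ f w τ
... | a ∷ b ∷ c ∷ [] , τ′ , refl = av (monotone-reflects mono a∈w c∈w fa<fc) (monotone-reflects mono c∈w b∈w fc<fb) τ′
  where
  a∈w : a ∈ w
  a∈w = ⊆-lookup τ′ (here refl)
  b∈w : b ∈ w
  b∈w = ⊆-lookup τ′ (there (here refl))
  c∈w : c ∈ w
  c∈w = ⊆-lookup τ′ (there (there (here refl)))

avoids-across : ∀ {pre m post x y} → Avoids132ˢ (pre ++ m ∷ post) → x ∈ pre → y ∈ post → y < m → ¬ x < y
avoids-across av x∈pre y∈post y<m x<y = av x<y y<m (++⁺ (from∈ x∈pre) (refl ∷ from∈ y∈post))

before after : ℕ → List ℕ → List ℕ
before m w = takeWhile (λ y → ¬? (y ≟ m)) w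
after m w = drop (suc (length (before m w))) w

split-at-first : ∀ {P : Pred ℕ p} (P? : Decidable P) {m w} → m ∈ w → ¬ P m → (∀ {y} → ¬ P y → y ≡ m) →
  w ≡ takeWhile P? w ++ m ∷ drop (suc (length (takeWhile P? w))) w
split-at-first P? {w = x ∷ w} m∈ ¬Pm onlyM with P? x
... | no ¬Px with onlyM ¬Px
...   | refl = refl
split-at-first P? {w = x ∷ w} (here refl) ¬Pm onlyM | yes Px = ⊥-elim (¬Pm Px)
split-at-first P? {w = x ∷ w} (there m∈w) ¬Pm onlyM | yes _ = cong (x ∷_) (split-at-first P? m∈w ¬Pm onlyM)

split-at : ∀ {m w} → m ∈ w → w ≡ before m w ++ m ∷ after m w
split-at {m} m∈w = split-at-first (λ y → ¬? (y ≟ m)) m∈w (λ m≢m → m≢m refl) (λ {y} → decidable-stable (y ≟ m))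

unique-++⁻ : ∀ xs {ys : List ℕ} → Unique (xs ++ ys) → Unique xs × Unique ys
unique-++⁻ [] u = [] , u
unique-++⁻ (x ∷ xs) (x∉ ∷ u) = (++⁻ˡ xs x∉ ∷ proj₁ (unique-++⁻ xs u)) , proj₂ (unique-++⁻ xs u)

-- The invariant carried through the recursion of θ: w is a 132-avoiding
-- permutation of 1, ..., |w|.
record Good (w : List ℕ) : Set where
  field
    unique : Unique w
    reduced : Reduced w
    avoids : Avoids132ˢ w

-- pre ++ m ∷ post with m the maximum and every entry of pre above every entry of post.
-- This is the shape of a 132-avoiding list around its maximum.
record MaxSplit (pre : List ℕ) (m : ℕ) (post : List ℕ) : Set where
  field
    pre<m : All (_< m) pre
    post<m : All (_< m) post
    pre≥post : ∀ {x y} → x ∈ pre → y ∈ post → ¬ x < y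

module _ {x xs} (good : Good (x ∷ xs)) where
  open Good good
  private
    w : List ℕ
    w = x ∷ xs
    m : ℕ
    m = length w

  split-good : w ≡ before m w ++ m ∷ after m w
  split-good = split-at (reduced-contains-length unique reduced)

  maxSplit-good : MaxSplit (before m w) m (after m w)
  maxSplit-good = record { pre<m = pre<m ; post<m = post<m ; pre≥post = pre≥post }
    where
    pre post : List ℕ
    pre = before m w
    post = after m w
    bounded : ∀ {y} → y ∈ pre ++ m ∷ post → y ≤ m
    bounded y∈ = reduced-bounded reduced (subst (_ ∈_) (sym split-good) y∈)
    pre<m : All (_< m) pre
    pre<m = All.tabulate (λ y∈pre → ≤∧≢⇒< (bounded (∈-++⁺ˡ y∈pre)) (All.lookup (all-takeWhile _ w) y∈pre))
    post<m : All (_< m) post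
    post<m with proj₂ (unique-++⁻ pre (subst Unique split-good unique))
    ... | m∉post ∷ _ = All.tabulate (λ y∈post →
      ≤∧≢⇒< (bounded (∈-++⁺ʳ pre (there y∈post))) (All.lookup m∉post y∈post ∘ sym))
    pre≥post : ∀ {x y} → x ∈ pre → y ∈ post → ¬ x < y
    pre≥post x∈pre y∈post = avoids-across (subst Avoids132ˢ split-good avoids) x∈pre y∈post (All.lookup post<m y∈post)

good-red-prefix : ∀ pre {m post} → Good (pre ++ m ∷ post) → Good (red pre)
good-red-prefix pre good = record
  { unique = unique-map (rank-monotone pre) (all-∈-self pre) (proj₁ (unique-++⁻ pre unique))
  ; reduced = red-reduced pre
  ; avoids = avoids-map (rank-monotone pre) (avoids-prefix pre avoids)
  }
  where open Good good

good-suffix : ∀ pre {m post} → MaxSplit pre m post → Good (pre ++ m ∷ post) → Good post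
good-suffix pre {m} {post} split good = record
  { unique = unique-post
  ; reduced = λ z∈post → trans (reduced (∈-++⁺ʳ pre (there z∈post))) (cong suc (rank-post z∈post))
  ; avoids = avoids-suffix (m ∷ []) (avoids-suffix pre avoids)
  }
  where
  open Good good
  open MaxSplit split
  unique-post : Unique post
  unique-post with proj₂ (unique-++⁻ pre unique)
  ... | _ ∷ u = u
  -- no entry of pre or m lies below an entry z of post
  rank-post : ∀ {z} → z ∈ post → count (_<? z) (pre ++ m ∷ post) ≡ count (_<? z) post
  rank-post {z} z∈post = begin
    count (_<? z) (pre ++ m ∷ post)              ≡⟨ count-++ (_<? z) pre (m ∷ post) ⟩
    count (_<? z) pre + count (_<? z) (m ∷ post)  ≡⟨ cong₂ _+_ (count-none (_<? z) (All.tabulate (λ x∈pre → pre≥post x∈pre z∈post)))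
                                                               (count-∷ (_<? z) m post) ⟩
    𝟙 (m <? z) + count (_<? z) post              ≡⟨ cong (_+ count (_<? z) post) (𝟙-no (<-asym (All.lookup post<m z∈post)) (m <? z)) ⟩
    count (_<? z) post                           ∎
    where open ≡-Reasoning

largerAfter-++ : ∀ k e c xs ys → All (λ x → count (x <?_) ys ≡ c) xs →
  largerAfter k e (xs ++ ys) ≡ largerAfter k (c + e) xs + largerAfter k e ys
largerAfter-++ k e c [] ys [] = refl
largerAfter-++ k e c (x ∷ xs) ys (x<ys ∷ xs<ys) = trans
  (cong₂ _+_ (cong (λ n → 𝟙 (k ≤? n)) credit) (largerAfter-++ k e c xs ys xs<ys))
  (sym (+-assoc (𝟙 (k ≤? c + e + count (x <?_) xs)) _ _))
  where
  credit : e + count (x <?_) (xs ++ ys) ≡ c + e + count (x <?_) xs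
  credit = begin
    e + count (x <?_) (xs ++ ys)            ≡⟨ cong (e +_) (count-++ (x <?_) xs ys) ⟩
    e + (count (x <?_) xs + count (x <?_) ys) ≡⟨ cong (λ n → e + (count (x <?_) xs + n)) x<ys ⟩
    e + (count (x <?_) xs + c)              ≡⟨ cong (e +_) (+-comm _ c) ⟩
    e + (c + count (x <?_) xs)              ≡⟨ +-assoc e c _ ⟨
    e + c + count (x <?_) xs                ≡⟨ cong (_+ count (x <?_) xs) (+-comm e c) ⟩
    c + e + count (x <?_) xs                ∎
    where open ≡-Reasoning

smallerBefore-acc : ∀ k {L L′} ys → (∀ {z} → z ∈ ys → count (_<? z) L ≡ count (_<? z) L′) →
  smallerBefore k L ys ≡ smallerBefore k L′ ys
smallerBefore-acc k [] same = refl
smallerBefore-acc k {L} {L′} (y ∷ ys) same = cong₂ _+_ (cong (λ n → 𝟙 (k ≤? n)) (same (here refl)))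
  (smallerBefore-acc k ys λ {z} z∈ys → trans (count-∷ (_<? z) y L)
    (trans (cong (𝟙 (y <? z) +_) (same (there z∈ys))) (sym (count-∷ (_<? z) y L′))))

smallerBefore-++ : ∀ k L xs ys → smallerBefore k L (xs ++ ys) ≡ smallerBefore k L xs + smallerBefore k (xs ++ L) ys
smallerBefore-++ k L [] ys = refl
smallerBefore-++ k L (x ∷ xs) ys = trans
  (cong (𝟙 (k ≤? count (_<? x) L) +_) (trans (smallerBefore-++ k (x ∷ L) xs ys)
    (cong (smallerBefore k (x ∷ L) xs +_) (smallerBefore-acc k ys (λ {z} _ → count-↭ (_<? z) (shift x xs L))))))
  (sym (+-assoc (𝟙 (k ≤? count (_<? x) L)) _ _))

-- Both statistics split along pre ++ m ∷ post like an in-order traversal: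
-- prefix, maximum, suffix.
module _ {pre m post} (split : MaxSplit pre m post) (k : ℕ) where
  open MaxSplit split

  largerAfter-split : ∀ e → largerAfter k e (pre ++ m ∷ post)
    ≡ largerAfter k (suc e) pre + (𝟙 (k ≤? e) + largerAfter k e post)
  largerAfter-split e = trans (largerAfter-++ k e 1 pre (m ∷ post) onlyM-above)
    (cong (λ n → largerAfter k (suc e) pre + (𝟙 (k ≤? n) + largerAfter k e post))
      (trans (cong (e +_) nothing-above-m) (+-identityʳ e)))
    where
    nothing-above-m : count (m <?_) post ≡ 0
    nothing-above-m = count-none (m <?_) (All.map (λ y<m m<y → <-asym y<m m<y) post<m)
    onlyM-above : All (λ x → count (x <?_) (m ∷ post) ≡ 1) pre
    onlyM-above = All.tabulate λ {x} x∈pre → trans (count-∷ (x <?_) m post)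
      (cong₂ _+_ (𝟙-yes (All.lookup pre<m x∈pre) (x <? m)) (count-none (x <?_) (All.tabulate (pre≥post x∈pre))))

  smallerBefore-split : smallerBefore k [] (pre ++ m ∷ post)
    ≡ smallerBefore k [] pre + (𝟙 (k ≤? length pre) + smallerBefore k [] post)
  smallerBefore-split = begin
    smallerBefore k [] (pre ++ m ∷ post)
      ≡⟨ smallerBefore-++ k [] pre (m ∷ post) ⟩
    smallerBefore k [] pre + smallerBefore k (pre ++ []) (m ∷ post)
      ≡⟨ cong (λ L → smallerBefore k [] pre + smallerBefore k L (m ∷ post)) (++-identityʳ pre) ⟩
    smallerBefore k [] pre + (𝟙 (k ≤? count (_<? m) pre) + smallerBefore k (m ∷ pre) post)
      ≡⟨ cong (smallerBefore k [] pre +_) (cong₂ _+_ (cong (λ n → 𝟙 (k ≤? n)) (count-all (_<? m) pre<m))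
                                                   (smallerBefore-acc k post (λ {z} z∈post → count-none (_<? z) (below-none z∈post)))) ⟩
    smallerBefore k [] pre + (𝟙 (k ≤? length pre) + smallerBefore k [] post)
      ∎
    where
    open ≡-Reasoning
    below-none : ∀ {z} → z ∈ post → All (λ x → ¬ x < z) (m ∷ pre)
    below-none z∈post = <-asym (All.lookup post<m z∈post) ∷ All.tabulate (λ x∈pre → pre≥post x∈pre z∈post)

leftDepthCount-node : ∀ k e l r → leftDepthCount' k e (node l r) ≡ leftDepthCount' k (suc e) l + (𝟙 (k ≤? e) + leftDepthCount' k e r)
leftDepthCount-node k e l r with k ≤? e
... | yes _ = sym (+-suc _ _)
... | no _ = refl

bigLeftCount-node : ∀ k l r → bigLeftCount k (node l r) ≡ bigLeftCount k l + (𝟙 (k ≤? size l) + bigLeftCount k r)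
bigLeftCount-node k l r with k ≤? size l
... | yes _ = sym (+-suc _ _)
... | no _ = refl

record Matches (k : ℕ) (t : BTree) (w : List ℕ) : Set where
  field
    size≡ : size t ≡ length w
    leftDepth≡ : ∀ e → largerAfter k e w ≡ leftDepthCount' k e t
    bigLeft≡ : smallerBefore k [] w ≡ bigLeftCount k t

node-matches : ∀ {k pre m post l r} → MaxSplit pre m post →
  Matches k l (red pre) → Matches k r post → Matches k (node l r) (pre ++ m ∷ post)
node-matches {k} {pre} {m} {post} {l} {r} split ml mr = record
  { size≡ = trans (cong suc (cong₂ _+_ size-l (size≡ mr))) (trans (sym (+-suc _ _)) (sym (length-++ pre)))
  ; leftDepth≡ = λ e → begin
      largerAfter k e (pre ++ m ∷ post)
        ≡⟨ largerAfter-split split k e ⟩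
      largerAfter k (suc e) pre + (𝟙 (k ≤? e) + largerAfter k e post)
        ≡⟨ cong₂ (λ a b → a + (𝟙 (k ≤? e) + b)) (trans (sym (largerAfter-map (rank-monotone pre) k (suc e) (all-∈-self pre)))
                                                       (leftDepth≡ ml (suc e)))
                                                (leftDepth≡ mr e) ⟩
      leftDepthCount' k (suc e) l + (𝟙 (k ≤? e) + leftDepthCount' k e r)
        ≡⟨ leftDepthCount-node k e l r ⟨
      leftDepthCount' k e (node l r)
        ∎
  ; bigLeft≡ = begin
      smallerBefore k [] (pre ++ m ∷ post)
        ≡⟨ smallerBefore-split split k ⟩
      smallerBefore k [] pre + (𝟙 (k ≤? length pre) + smallerBefore k [] post)
        ≡⟨ cong₂ (λ a b → a + (𝟙 (k ≤? b) + smallerBefore k [] post)) (trans (sym (smallerBefore-map (rank-monotone pre) k [] (all-∈-self pre)))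
                                                   (bigLeft≡ ml))
                                            (sym size-l) ⟩
      bigLeftCount k l + (𝟙 (k ≤? size l) + smallerBefore k [] post)
        ≡⟨ cong (λ b → bigLeftCount k l + (𝟙 (k ≤? size l) + b)) (bigLeft≡ mr) ⟩
      bigLeftCount k l + (𝟙 (k ≤? size l) + bigLeftCount k r)
        ≡⟨ bigLeftCount-node k l r ⟨
      bigLeftCount k (node l r)
        ∎
  }
  where
  open Matches
  open ≡-Reasoning
  size-l : size l ≡ length pre
  size-l = trans (size≡ ml) (length-map (rank pre) pre)

split-lengths : ∀ {x : ℕ} {xs} pre {m} post → x ∷ xs ≡ pre ++ m ∷ post → length pre ≤ length xs × length post ≤ length xs
split-lengths {xs = xs} pre post eq = ≤-trans (m≤m+n _ _) (≤-reflexive total) , ≤-trans (m≤n+m _ _) (≤-reflexive total)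
  where
  total : length pre + length post ≡ length xs
  total = suc-injective (sym (trans (cong length eq) (trans (length-++ pre) (+-suc _ _))))

θ-matches : ∀ k f w → length w ≤ f → Good w → Matches k (θ-fuel f w) w
θ-matches k f [] _ _ = record { size≡ = refl ; leftDepth≡ = λ _ → refl ; bigLeft≡ = refl }
θ-matches k (suc f) w@(x ∷ xs) (s≤s |xs|≤f) good =
  subst (Matches k _) (sym split) (node-matches (maxSplit-good good)
    (θ-matches k f (red pre) (subst (_≤ f) (sym (length-map (rank pre) pre)) (≤-trans (proj₁ shorter) |xs|≤f))
                             (good-red-prefix pre good′))
    (θ-matches k f post (≤-trans (proj₂ shorter) |xs|≤f) (good-suffix pre (maxSplit-good good) good′)))
  where
  m : ℕ
  m = length w
  pre post : List ℕ
  pre = before m w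
  post = after m w
  split : w ≡ pre ++ m ∷ post
  split = split-good good
  good′ : Good (pre ++ m ∷ post)
  good′ = subst Good split good
  shorter : length pre ≤ length xs × length post ≤ length xs
  shorter = split-lengths pre post split

count-below-suc : ∀ i xs → count (_<? suc i) (map suc xs) ≡ count (_<? i) xs
count-below-suc i xs = trans (count-map (_<? suc i) suc xs) (count-cong _ (_<? i) xs (λ _ → s≤s⁻¹) (λ _ → s≤s))

count-below-upTo : ∀ {i n} → i ≤ n → count (_<? i) (upTo n) ≡ i
count-below-upTo {zero} {n} _ = count-none (_<? 0) {upTo n} (All.tabulate (λ _ ()))
count-below-upTo {suc i} {suc n} (s≤s i≤n) = cong suc (trans (cong (count (_<? suc i)) (sym (map-upTo suc n)))
  (trans (count-below-suc i (upTo n)) (count-below-upTo i≤n)))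

perm-good : ∀ {n σ} → IsPerm n σ → Avoids132 σ → Good σ
perm-good {n} {σ} perm av = record
  { unique = Unique-resp-↭ (setoid ℕ) (↭⇒↭ₛ (↭-sym perm)) (Unique-map⁺ suc-injective (upTo⁺ n))
  ; reduced = reduced
  ; avoids = avoids132ˢ σ av
  }
  where
  reduced : Reduced σ
  reduced x∈σ with ∈-map⁻ suc (∈-resp-↭ perm x∈σ)
  ... | i , i∈upTo , refl = cong suc (sym (trans (count-↭ (_<? suc i) perm)
    (trans (count-below-suc i (upTo n)) (count-below-upTo (<⇒≤ (∈-upTo⁻ i∈upTo))))))

-- The main theorem: rewrite both mmp statistics as list scans and read them off the
-- tree θ σ via θ-matches.
theorem4 : (k n : ℕ) (σ : List ℕ) → 1 ≤ k → IsPerm n σ → Avoids132 σ →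
    (mmp k 0 0 0 σ ≡ leftDepthCount k (θ σ))
    × (mmp 0 0 k 0 σ ≡ bigLeftCount k (θ σ))
theorem4 k n σ _ perm av =
  trans (mmp-largerAfter k σ) (leftDepth≡ 0) , trans (mmp-smallerBefore k σ) bigLeft≡
  where
  open Matches (θ-matches k (length σ) σ ≤-refl (perm-good perm av))
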